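{- Let $n \ge 2k + 1 \ge 5$ and let $Q$ be an independent set in the Kneser graph $K(n,k)$. If we uniquely expand $$|Q| = \binom{q_{n-k}}{n-k} + \binom{q_{n-k-1}}{n-k-1} + \cdots + \binom{q_j}{j},$$ where $q_{n-k} > q_{n-k-1} > \ldots > q_j \ge j \ge 1$ are natural numbers, then $$|N(Q)| \ge \binom{q_{n-k}}{k} + \binom{q_{n-k-1}}{k-1} + \cdots + \binom{q_j}{j-(n-2k)}.$$
   Context: The Kneser graph $K(n,k)$ has as vertices the $k$-element subsets of $[n]=\{1,\dots,n\}$, two vertices adjacent iff the subsets are disjoint. For a set $Q$ of vertices of a graph, $N(Q)$ denotes the set of vertices not in $Q$ that are adjacent to some vertex of $Q$. Binomial coefficients $\binom{a}{b}$ with $b<0$ are taken to be $0$. -}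

module Defs where

open import Data.Nat using (ℕ; zero; suc; _+_; _∸_; _<ᵇ_; _≟_)
open import Data.Nat.Combinatorics using (_C_)
open import Data.Bool using (if_then_else_)
import Data.Bool as Bool
open import Data.Vec using ([]; _∷_)
import Data.Vec.Properties as VecP
open import Data.List using (List; []; _∷_; [_]; map; _++_; length; filter; applyUpTo)
open import Data.Nat.ListAction using (sum)
open import Data.List.Relation.Unary.Any using (Any; any?)
open import Data.List.Membership.Propositional using (_∈_; _∉_)
import Data.List.Membership.DecPropositional as DecMem
open import Data.Fin.Subset using (Subset; inside; outside; _∩_; ∣_∣; Empty)
open import Data.Fin.Subset.Properties using (nonempty?)
open import Data.Product using (_×_)
open import Relation.Nullary using (¬?; _×-dec_)
open import Relation.Nullary.Decidable using (Dec)
open import Relation.Binary.PropositionalEquality using (_≡_)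

allSubsets : (n : ℕ) → List (Subset n)
allSubsets zero = [ [] ]
allSubsets (suc n) = map (inside ∷_) (allSubsets n) ++ map (outside ∷_) (allSubsets n)

KAdj : ∀ {n} → Subset n → Subset n → Set
KAdj A B = Empty (A ∩ B)

KAdj? : ∀ {n} (A B : Subset n) → Dec (KAdj A B)
KAdj? A B = ¬? (nonempty? (A ∩ B))

IsIndependent : ∀ {n} → ℕ → List (Subset n) → Set
IsIndependent {n} k Q =
  (∀ {A} → A ∈ Q → ∣ A ∣ ≡ k) ×
  (∀ {A B} → A ∈ Q → B ∈ Q → ¬ KAdj A B)
  where open import Relation.Nullary using (¬_)

InNbhd : ∀ {n} → ℕ → List (Subset n) → Subset n → Set
InNbhd k Q v = (∣ v ∣ ≡ k) × (v ∉ Q) × Any (λ A → KAdj A v) Q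

InNbhd? : ∀ {n} (k : ℕ) (Q : List (Subset n)) (v : Subset n) → Dec (InNbhd k Q v)
InNbhd? k Q v = (∣ v ∣ ≟ k) ×-dec (¬? (DecMem._∈?_ (VecP.≡-dec Bool._≟_) v Q) ×-dec any? (λ A → KAdj? A v) Q)

nbhdSize : (n k : ℕ) → List (Subset n) → ℕ
nbhdSize n k Q = length (filter (InNbhd? k Q) (allSubsets n))

-- Σ_{i=j}^{m} f i  (empty if m < j).
sumFromTo : ℕ → ℕ → (ℕ → ℕ) → ℕ
sumFromTo j m f = sum (applyUpTo (λ d → f (j + d)) (suc m ∸ j))

-- Binomial coefficient a choose (i - s) with integer lower index i - s,
-- taken to be 0 when i - s < 0.
chooseShift : ℕ → ℕ → ℕ → ℕ
chooseShift a i s = if i <ᵇ s then 0 else a C (i ∸ s)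

-- Taking complements turns Q into an (n ∸ k)-uniform family F with |F| = |Q|, and every
-- k-set inside a member of F is disjoint from the complementary member of Q, hence (Q being
-- independent) a neighbour of Q. So |N(Q)| is at least the size of the (n ∸ 2k)-fold shadow
-- of F, which the Kruskal–Katona theorem in cascade form bounds from below.
--
-- Kruskal–Katona is proved by induction on the ground set. Compressing towards the element 0
-- preserves |F| and does not enlarge shadows, so F may be taken compressed, and then the
-- shadow of the deletion of 0 lies in the link of 0. Pascal's rule splits the cascade sum into
-- a link part and a deletion part; the link is at least as large as its part (otherwise the
-- deletion exceeds its part and its shadow overflows the link), and the induction hypothesis
-- for the link yields both halves of the bound.

module Submission where

open import Algebra.Properties.CommutativeSemigroup using (interchange)
open import Data.Bool using (Bool; true; false; _∧_; _∨_; if_then_else_; T)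
import Data.Bool as Bool
open import Data.Bool.Properties using (T?; T-∧; T-∨)
open import Data.Empty using (⊥-elim)
open import Data.Fin using (Fin; zero; suc)
open import Data.Fin.Properties using (any?)
open import Data.Fin.Subset using (Subset; inside; outside; ∣_∣; ∁; _∩_; _⊆_; Empty)
open import Data.Fin.Subset.Properties
  using (anySubset?; _⊆?_; drop-∷-⊆; in⊆in; out⊆; s⊆s; ⊆-refl; ⊆-trans; p⊆q⇒∣p∣≤∣q∣; ∣∁p∣≡n∸∣p∣; ∣p∣≤n; x∈p∩q⁻; x∈∁p⇒x∉p)
open import Data.List using (List; []; _∷_; map; _++_; length; filter; applyUpTo)
open import Data.List.Membership.Propositional using (_∈_)
import Data.List.Membership.DecPropositional as DecMembership
open import Data.List.Properties using (length-++; filter-++)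
open import Data.List.Relation.Unary.All using (_∷_)
open import Data.List.Relation.Unary.All.Properties using (All¬⇒¬Any)
open import Data.List.Relation.Unary.AllPairs using (_∷_)
import Data.List.Relation.Unary.Any as Any
open import Data.List.Relation.Unary.Unique.Propositional using (Unique)
open import Data.Nat using (ℕ; zero; suc; _+_; _*_; _∸_; _≤_; _<_; z≤n; s≤s; _<?_; _≟_)
open import Data.Nat.Combinatorics using (_C_; nCk+nC[k+1]≡[n+1]C[k+1]; nCk≡nC[n∸k]; nC1≡n; nCn≡1)
open import Data.Nat.Combinatorics.Specification using (k>n⇒nCk≡0)
open import Data.Nat.Induction using (<-wellFounded)
open import Data.Nat.ListAction using (sum)
open import Data.Nat.Properties
open import Data.Product using (∃; _×_; _,_; proj₁; proj₂)
open import Data.Sum using (inj₁; inj₂)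
open import Data.Unit using (⊤; tt)
open import Data.Vec using (_∷_; []; lookup; _[_]≔_; here; there)
open import Data.Vec.Properties using ([]=⇒lookup; lookup⇒[]=; lookup∘update; []≔-idempotent; []≔-lookup)
import Data.Vec.Properties as VecProperties
open import Defs
open import Function using (_∘_; _on_)
open import Function.Bundles using (Equivalence)
open import Induction.WellFounded using (Acc; acc)
import Relation.Binary.Construct.On as On
open import Relation.Binary.Definitions using (DecidableEquality; tri<; tri≈; tri>)
open import Relation.Binary.PropositionalEquality
open import Relation.Nullary using (Dec; yes; no; does; ¬_; ¬?; contradiction)
open import Relation.Nullary.Decidable using (isYes; _×-dec_; toWitness; fromWitness; dec-true; dec-false; decidable-stable)
open import Relation.Unary using (Pred; Decidable)

open Equivalence using (to; from)

-- Counting subsets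

sumSubsets : ∀ n → (Subset n → ℕ) → ℕ
sumSubsets zero    h = h []
sumSubsets (suc n) h = sumSubsets n (h ∘ (inside ∷_)) + sumSubsets n (h ∘ (outside ∷_))

sumSubsets-mono : ∀ {n} {g h : Subset n → ℕ} → (∀ A → g A ≤ h A) → sumSubsets n g ≤ sumSubsets n h
sumSubsets-mono {zero}  g≤h = g≤h []
sumSubsets-mono {suc n} g≤h = +-mono-≤ (sumSubsets-mono (g≤h ∘ (inside ∷_))) (sumSubsets-mono (g≤h ∘ (outside ∷_)))

sumSubsets-cong : ∀ {n} {g h : Subset n → ℕ} → (∀ A → g A ≡ h A) → sumSubsets n g ≡ sumSubsets n h
sumSubsets-cong g≡h = ≤-antisym (sumSubsets-mono (≤-reflexive ∘ g≡h)) (sumSubsets-mono (≤-reflexive ∘ sym ∘ g≡h))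

sumSubsets-mono-< : ∀ {n} {g h : Subset n → ℕ} → (∀ A → g A ≤ h A) →
                    ∀ B → g B < h B → sumSubsets n g < sumSubsets n h
sumSubsets-mono-< {zero}  g≤h []             g<h = g<h
sumSubsets-mono-< {suc n} g≤h (inside ∷ B)  g<h =
  +-mono-<-≤ (sumSubsets-mono-< (g≤h ∘ (inside ∷_)) B g<h) (sumSubsets-mono (g≤h ∘ (outside ∷_)))
sumSubsets-mono-< {suc n} g≤h (outside ∷ B) g<h =
  +-mono-≤-< (sumSubsets-mono (g≤h ∘ (inside ∷_))) (sumSubsets-mono-< (g≤h ∘ (outside ∷_)) B g<h)

sumSubsets-+ : ∀ {n} (g h : Subset n → ℕ) → sumSubsets n (λ A → g A + h A) ≡ sumSubsets n g + sumSubsets n h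
sumSubsets-+ {zero}  g h = refl
sumSubsets-+ {suc n} g h =
  trans (cong₂ _+_ (sumSubsets-+ (g ∘ (inside ∷_)) (h ∘ (inside ∷_))) (sumSubsets-+ (g ∘ (outside ∷_)) (h ∘ (outside ∷_))))
        (interchange +-commutativeSemigroup (sumSubsets n (g ∘ (inside ∷_))) _ _ _)

sumSubsets-zero : ∀ n → sumSubsets n (λ _ → 0) ≡ 0
sumSubsets-zero zero    = refl
sumSubsets-zero (suc n) = cong₂ _+_ (sumSubsets-zero n) (sumSubsets-zero n)

sumSubsets-∁ : ∀ {n} (h : Subset n → ℕ) → sumSubsets n (h ∘ ∁) ≡ sumSubsets n h
sumSubsets-∁ {zero}  h = refl
sumSubsets-∁ {suc n} h =
  trans (cong₂ _+_ (sumSubsets-∁ (h ∘ (outside ∷_))) (sumSubsets-∁ (h ∘ (inside ∷_)))) (+-comm (sumSubsets n (h ∘ (outside ∷_))) _)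

sumSubsets-pairUp : ∀ {n} (x : Fin n) (h : Subset n → ℕ) →
  sumSubsets n h ≡ sumSubsets n (λ A → if lookup A x then 0 else h A + h (A [ x ]≔ inside))
sumSubsets-pairUp {suc n} zero h = begin
  sumSubsets n (h ∘ (inside ∷_)) + sumSubsets n (h ∘ (outside ∷_))
    ≡⟨ +-comm (sumSubsets n (h ∘ (inside ∷_))) _ ⟩
  sumSubsets n (h ∘ (outside ∷_)) + sumSubsets n (h ∘ (inside ∷_))
    ≡⟨ sym (sumSubsets-+ (h ∘ (outside ∷_)) (h ∘ (inside ∷_))) ⟩
  sumSubsets n (λ A → h (outside ∷ A) + h (inside ∷ A))
    ≡⟨ cong (_+ sumSubsets n (λ A → h (outside ∷ A) + h (inside ∷ A))) (sym (sumSubsets-zero n)) ⟩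
  sumSubsets n (λ _ → 0) + sumSubsets n (λ A → h (outside ∷ A) + h (inside ∷ A)) ∎
  where open ≡-Reasoning
sumSubsets-pairUp {suc n} (suc x) h =
  cong₂ _+_ (sumSubsets-pairUp x (h ∘ (inside ∷_))) (sumSubsets-pairUp x (h ∘ (outside ∷_)))

sumSubsets-pairUp-cong : ∀ {n} (x : Fin n) {g h : Subset n → ℕ} →
  (∀ A → lookup A x ≡ outside → g A + g (A [ x ]≔ inside) ≡ h A + h (A [ x ]≔ inside)) →
  sumSubsets n g ≡ sumSubsets n h
sumSubsets-pairUp-cong x {g} {h} pairs≡ =
  trans (sumSubsets-pairUp x g) (trans (sumSubsets-cong pointwise) (sym (sumSubsets-pairUp x h)))
  where
  pointwise : ∀ A → (if lookup A x then 0 else g A + g (A [ x ]≔ inside))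
                  ≡ (if lookup A x then 0 else h A + h (A [ x ]≔ inside))
  pointwise A with lookup A x in x∈?A
  ... | inside  = refl
  ... | outside = pairs≡ A x∈?A

Family : ℕ → Set
Family n = Subset n → Bool

𝟙 : Bool → ℕ
𝟙 b = if b then 1 else 0

count : ∀ {n} → Family n → ℕ
count {n} F = sumSubsets n (𝟙 ∘ F)

𝟙-mono : ∀ {a b} → (T a → T b) → 𝟙 a ≤ 𝟙 b
𝟙-mono {false} a⇒b = z≤n
𝟙-mono {true} {true} a⇒b = ≤-refl
𝟙-mono {true} {false} a⇒b = ⊥-elim (a⇒b _)

count-mono : ∀ {n} {F G : Family n} → (∀ A → T (F A) → T (G A)) → count F ≤ count G
count-mono F⊆G = sumSubsets-mono (λ A → 𝟙-mono (F⊆G A))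

count-mono-< : ∀ {n} {F G : Family n} → (∀ A → T (F A) → T (G A)) →
               ∀ B → ¬ T (F B) → T (G B) → count F < count G
count-mono-< F⊆G B B∉F B∈G = sumSubsets-mono-< (λ A → 𝟙-mono (F⊆G A)) B (𝟙-< B∉F B∈G)
  where
  𝟙-< : ∀ {a b} → ¬ T a → T b → 𝟙 a < 𝟙 b
  𝟙-< {false} {true} _ _ = s≤s z≤n
  𝟙-< {true}         ¬a _ = ⊥-elim (¬a _)

-- Shadows

IsUniform : ∀ {n} → ℕ → Family n → Set
IsUniform {n} r F = ∀ (A : Subset n) → T (F A) → ∣ A ∣ ≡ r

link : ∀ {n} → Family (suc n) → Family n
link F A = F (inside ∷ A)

deletion : ∀ {n} → Family (suc n) → Family n
deletion F A = F (outside ∷ A)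

-- For an r-uniform family, shadow s is its (r ∸ s)-fold iterated shadow.
shadow : ∀ {n} → ℕ → Family n → Family n
shadow s F B = isYes ((∣ B ∣ ≟ s) ×-dec anySubset? (λ A → T? (F A) ×-dec B ⊆? A))

shadow⁺ : ∀ {n s} {F : Family n} {A B} → ∣ B ∣ ≡ s → B ⊆ A → T (F A) → T (shadow s F B)
shadow⁺ {A = A} ∣B∣≡s B⊆A A∈F = fromWitness (∣B∣≡s , A , A∈F , λ {x} → B⊆A)

shadow⁻ : ∀ {n s} {F : Family n} {B} → T (shadow s F B) → ∣ B ∣ ≡ s × ∃ λ A → T (F A) × B ⊆ A
shadow⁻ B∈∂F = toWitness B∈∂F

count-shadow-self : ∀ {n r} {F : Family n} → IsUniform r F → count F ≤ count (shadow r F)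
count-shadow-self F-unif = count-mono (λ A A∈F → shadow⁺ (F-unif A A∈F) ⊆-refl A∈F)

module _ {n s} (G : Family (suc n)) {B : Subset n} (B∈∂G₁ : T (shadow s (link G) B)) where

  shadow-link⇒inside : T (shadow (suc s) G (inside ∷ B))
  shadow-link⇒inside with ∣B∣≡s , A , A∈G , B⊆A ← shadow⁻ B∈∂G₁ = shadow⁺ (cong suc ∣B∣≡s) (in⊆in B⊆A) A∈G

  shadow-link⇒outside : T (shadow s G (outside ∷ B))
  shadow-link⇒outside with ∣B∣≡s , A , A∈G , B⊆A ← shadow⁻ B∈∂G₁ = shadow⁺ ∣B∣≡s (out⊆ B⊆A) A∈G

count-shadow-link : ∀ {n} s (G : Family (suc n)) →
  count (shadow s (link G)) + count (shadow (suc s) (link G)) ≤ count (shadow (suc s) G)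
count-shadow-link s G =
  +-mono-≤ (count-mono {G = link (shadow (suc s) G)} (λ _ → shadow-link⇒inside G))
           (count-mono {G = deletion (shadow (suc s) G)} (λ _ → shadow-link⇒outside G))

count-shadow-link-≤ : ∀ {n} s (G : Family (suc n)) → count (shadow s (link G)) ≤ count (shadow s G)
count-shadow-link-≤ s G =
  ≤-trans (count-mono {G = deletion (shadow s G)} (λ _ → shadow-link⇒outside G)) (m≤n+m _ (count (link (shadow s G))))

count-shadow-via-link : ∀ {n} r t (G : Family (suc n)) {X Y} →
  X ≤ count (shadow (r ∸ suc t) (link G)) → Y ≤ count (shadow (r ∸ t) (link G)) → (r ≤ t → X ≡ 0) →
  X + Y ≤ count (shadow (r ∸ t) G)
count-shadow-via-link r t G {X} {Y} X≤ Y≤ X≡0 with t <? r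
... | yes t<r = begin
  X + Y                                                                            ≤⟨ +-mono-≤ X≤ (≤-trans Y≤ (≤-reflexive (cong ∂G₁ r∸t≡1+r∸[1+t]))) ⟩
  count (shadow (r ∸ suc t) (link G)) + count (shadow (suc (r ∸ suc t)) (link G)) ≤⟨ count-shadow-link (r ∸ suc t) G ⟩
  count (shadow (suc (r ∸ suc t)) G)                                               ≡⟨ cong (λ s → count (shadow s G)) r∸t≡1+r∸[1+t] ⟨
  count (shadow (r ∸ t) G)                                                         ∎
  where
  open ≤-Reasoning
  ∂G₁ = λ s → count (shadow s (link G))
  r∸t≡1+r∸[1+t] : r ∸ t ≡ suc (r ∸ suc t)
  r∸t≡1+r∸[1+t] = +-∸-assoc 1 t<r
... | no t≮r = begin
  X + Y                           ≡⟨ cong (_+ Y) (X≡0 (≮⇒≥ t≮r)) ⟩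
  Y                               ≤⟨ Y≤ ⟩
  count (shadow (r ∸ t) (link G)) ≤⟨ count-shadow-link-≤ (r ∸ t) G ⟩
  count (shadow (r ∸ t) G)        ∎
  where open ≤-Reasoning

-- Compression

∷-⊆ : ∀ {n} {a b} {A B C D : Subset n} → a ∷ A ⊆ b ∷ B → C ⊆ D → a ∷ C ⊆ b ∷ D
∷-⊆ aA⊆bB C⊆D here with here ← aA⊆bB here = here
∷-⊆ aA⊆bB C⊆D (there y∈C) = there (C⊆D y∈C)

⊆-lookup : ∀ {n} {A B : Subset n} x → A ⊆ B → lookup A x ≡ inside → lookup B x ≡ inside
⊆-lookup {A = A} x A⊆B x∈A = []=⇒lookup (A⊆B (lookup⇒[]= x A x∈A))

⊆-lookup-outside : ∀ {n} {A B : Subset n} x → A ⊆ B → lookup B x ≡ outside → lookup A x ≡ outside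
⊆-lookup-outside {A = A} x A⊆B x∉B with lookup A x in x∈?A
... | outside = refl
... | inside  = contradiction (trans (sym (⊆-lookup x A⊆B x∈?A)) x∉B) λ ()

≔-⊆ : ∀ {n} {A B : Subset n} x b → A ⊆ B → A [ x ]≔ b ⊆ B [ x ]≔ b
≔-⊆ {A = _ ∷ _} {_ ∷ _} zero    b A⊆B = s⊆s (drop-∷-⊆ A⊆B)
≔-⊆ {A = _ ∷ _} {_ ∷ _} (suc x) b A⊆B = ∷-⊆ A⊆B (≔-⊆ x b (drop-∷-⊆ A⊆B))

≔outside-⊆ : ∀ {n} (A : Subset n) x → A [ x ]≔ outside ⊆ A
≔outside-⊆ (_ ∷ A) zero    = out⊆ ⊆-refl
≔outside-⊆ (_ ∷ A) (suc x) = s⊆s (≔outside-⊆ A x)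

⊆-≔inside : ∀ {n} (A : Subset n) x → A ⊆ A [ x ]≔ inside
⊆-≔inside (inside ∷ A)  zero    = ⊆-refl
⊆-≔inside (outside ∷ A) zero    = out⊆ ⊆-refl
⊆-≔inside (_ ∷ A)       (suc x) = s⊆s (⊆-≔inside A x)

∣≔inside∣ : ∀ {n} (A : Subset n) x → lookup A x ≡ outside → ∣ A [ x ]≔ inside ∣ ≡ suc ∣ A ∣
∣≔inside∣ (outside ∷ A) zero    refl = refl
∣≔inside∣ (inside ∷ A)  (suc x) x∉A  = cong suc (∣≔inside∣ A x x∉A)
∣≔inside∣ (outside ∷ A) (suc x) x∉A  = ∣≔inside∣ A x x∉A

∣≔outside∣ : ∀ {n} (A : Subset n) x → lookup A x ≡ inside → suc ∣ A [ x ]≔ outside ∣ ≡ ∣ A ∣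
∣≔outside∣ (inside ∷ A)  zero    refl = refl
∣≔outside∣ (inside ∷ A)  (suc x) x∈A  = cong suc (∣≔outside∣ A x x∈A)
∣≔outside∣ (outside ∷ A) (suc x) x∈A  = ∣≔outside∣ A x x∈A

≔-≔-restore : ∀ {n} (A : Subset n) x {b c} → lookup A x ≡ b → (A [ x ]≔ c) [ x ]≔ b ≡ A
≔-≔-restore A x refl = trans ([]≔-idempotent A x) ([]≔-lookup A x)

-- Moves each member containing suc x but not zero (the head coordinate) to its image under
-- swapping the two, unless that image is already a member.
compress : ∀ {n} → Fin n → Family (suc n) → Family (suc n)
compress x F (inside ∷ A)  = if lookup A x then F (inside ∷ A) else F (inside ∷ A) ∨ F (outside ∷ A [ x ]≔ inside)
compress x F (outside ∷ A) = if lookup A x then F (outside ∷ A) ∧ F (inside ∷ A [ x ]≔ outside) else F (outside ∷ A)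

module _ {n} (x : Fin n) where

  SwapClosed : Family (suc n) → Subset (suc n) → Set
  SwapClosed F (inside ∷ A)  = ⊤
  SwapClosed F (outside ∷ A) = lookup A x ≡ inside → T (F (inside ∷ A [ x ]≔ outside))

  compress⁺-kept : ∀ F A → T (F A) → SwapClosed F A → T (compress x F A)
  compress⁺-kept F (inside ∷ A) A∈F _ with lookup A x
  ... | inside  = A∈F
  ... | outside = from T-∨ (inj₁ A∈F)
  compress⁺-kept F (outside ∷ A) A∈F swap with lookup A x
  ... | inside  = from T-∧ (A∈F , swap refl)
  ... | outside = A∈F

  compress⁺-moved : ∀ F A → lookup A x ≡ outside → T (F (outside ∷ A [ x ]≔ inside)) → T (compress x F (inside ∷ A))
  compress⁺-moved F A x∉A A⁺∈F rewrite x∉A = from T-∨ (inj₂ A⁺∈F)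

  data CompressWitness (F : Family (suc n)) : Subset (suc n) → Set where
    kept  : ∀ {A} → T (F A) → SwapClosed F A → CompressWitness F A
    moved : ∀ {A} → lookup A x ≡ outside → T (F (outside ∷ A [ x ]≔ inside)) → CompressWitness F (inside ∷ A)

  compress⁻ : ∀ {F} A → T (compress x F A) → CompressWitness F A
  compress⁻ {F} (inside ∷ A) A∈CF with lookup A x in x∈?A
  ... | inside  = kept A∈CF tt
  ... | outside with to T-∨ A∈CF
  ...   | inj₁ A∈F  = kept A∈F tt
  ...   | inj₂ A⁺∈F = moved x∈?A A⁺∈F
  compress⁻ {F} (outside ∷ A) A∈CF with lookup A x in x∈?A
  ... | inside  = kept (proj₁ (to T-∧ A∈CF)) (λ _ → proj₂ (to T-∧ A∈CF))
  ... | outside = kept A∈CF (λ x∈A → contradiction (trans (sym x∈?A) x∈A) λ ())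

  compress-uniform : ∀ {r F} → IsUniform r F → IsUniform r (compress x F)
  compress-uniform F-unif A A∈CF with compress⁻ A A∈CF
  ... | kept A∈F _             = F-unif A A∈F
  ... | moved {A} x∉A A⁺∈F = trans (sym (∣≔inside∣ A x x∉A)) (F-unif _ A⁺∈F)

  count-compress : ∀ F → count (compress x F) ≡ count F
  count-compress F = begin
    count (compress x F)                                              ≡⟨ sumSubsets-+ (𝟙 ∘ link CF) (𝟙 ∘ deletion CF) ⟨
    sumSubsets n (λ A → 𝟙 (CF (inside ∷ A)) + 𝟙 (CF (outside ∷ A))) ≡⟨ sumSubsets-pairUp-cong x pairs≡ ⟩
    sumSubsets n (λ A → 𝟙 (F (inside ∷ A)) + 𝟙 (F (outside ∷ A)))   ≡⟨ sumSubsets-+ (𝟙 ∘ link F) (𝟙 ∘ deletion F) ⟩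
    count F                                                           ∎
    where
    open ≡-Reasoning
    CF = compress x F
    -- Compression only moves members from outside ∷ A [ x ]≔ inside to inside ∷ A.
    pairs≡ : ∀ A → lookup A x ≡ outside →
      𝟙 (CF (inside ∷ A)) + 𝟙 (CF (outside ∷ A)) + (𝟙 (CF (inside ∷ A [ x ]≔ inside)) + 𝟙 (CF (outside ∷ A [ x ]≔ inside)))
      ≡ 𝟙 (F (inside ∷ A)) + 𝟙 (F (outside ∷ A)) + (𝟙 (F (inside ∷ A [ x ]≔ inside)) + 𝟙 (F (outside ∷ A [ x ]≔ inside)))
    pairs≡ A x∉A rewrite x∉A | lookup∘update x A inside | ≔-≔-restore A x {c = inside} x∉A
      with F (inside ∷ A) | F (outside ∷ A [ x ]≔ inside)
    ... | true  | true  = refl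
    ... | true  | false = refl
    ... | false | false = refl
    ... | false | true  = move-one (𝟙 (F (outside ∷ A))) (𝟙 (F (inside ∷ A [ x ]≔ inside)))
      where
      move-one : ∀ d c → 1 + d + (c + 0) ≡ 0 + d + (c + 1)
      move-one d c = sym (trans (cong (d +_) (+-suc c 0)) (+-suc d (c + 0)))

  shadow-compress : ∀ {s F} B → T (shadow s (compress x F) B) → T (compress x (shadow s F) B)
  shadow-compress {s} {F} B B∈∂CF with ∣B∣≡s , A , A∈CF , B⊆A ← shadow⁻ B∈∂CF = below (compress⁻ A A∈CF) B B⊆A ∣B∣≡s
    where
    ∂F = shadow s F
    below : ∀ {A} → CompressWitness F A → ∀ B → B ⊆ A → ∣ B ∣ ≡ s → T (compress x ∂F B)
    below (kept A∈F _) (inside ∷ V) B⊆A ∣B∣≡s = compress⁺-kept ∂F (inside ∷ V) (shadow⁺ ∣B∣≡s B⊆A A∈F) tt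
    below {inside ∷ W} (kept A∈F _) (outside ∷ V) B⊆A ∣B∣≡s =
      compress⁺-kept ∂F (outside ∷ V) (shadow⁺ ∣B∣≡s B⊆A A∈F) λ x∈V →
        shadow⁺ (trans (∣≔outside∣ V x x∈V) ∣B∣≡s) (in⊆in (⊆-trans (≔outside-⊆ V x) (drop-∷-⊆ B⊆A))) A∈F
    below {outside ∷ W} (kept A∈F swapA) (outside ∷ V) B⊆A ∣B∣≡s =
      compress⁺-kept ∂F (outside ∷ V) (shadow⁺ ∣B∣≡s B⊆A A∈F) λ x∈V →
        shadow⁺ (trans (∣≔outside∣ V x x∈V) ∣B∣≡s) (in⊆in (≔-⊆ x outside (drop-∷-⊆ B⊆A)))
                (swapA (⊆-lookup x (drop-∷-⊆ B⊆A) x∈V))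
    below (moved {W} x∉W W⁺∈F) (inside ∷ V) B⊆A ∣B∣≡s =
      compress⁺-moved ∂F V x∉V (shadow⁺ (trans (∣≔inside∣ V x x∉V) ∣B∣≡s) (s⊆s (≔-⊆ x inside (drop-∷-⊆ B⊆A))) W⁺∈F)
      where x∉V = ⊆-lookup-outside x (drop-∷-⊆ B⊆A) x∉W
    below (moved {W} x∉W W⁺∈F) (outside ∷ V) B⊆A ∣B∣≡s =
      compress⁺-kept ∂F (outside ∷ V) (shadow⁺ ∣B∣≡s (out⊆ (⊆-trans (drop-∷-⊆ B⊆A) (⊆-≔inside W x))) W⁺∈F) λ x∈V →
        contradiction (trans (sym (⊆-lookup-outside x (drop-∷-⊆ B⊆A) x∉W)) x∈V) λ ()

  count-shadow-compress : ∀ s F → count (shadow s (compress x F)) ≤ count (shadow s F)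
  count-shadow-compress s F = begin
    count (shadow s (compress x F)) ≤⟨ count-mono shadow-compress ⟩
    count (compress x (shadow s F)) ≡⟨ count-compress (shadow s F) ⟩
    count (shadow s F)              ∎
    where open ≤-Reasoning

  Violation : Family (suc n) → Subset n → Set
  Violation F A = T (F (outside ∷ A)) × lookup A x ≡ inside × ¬ T (F (inside ∷ A [ x ]≔ outside))

  count-deletion-compress-< : ∀ {F A} → Violation F A → count (deletion (compress x F)) < count (deletion F)
  count-deletion-compress-< {F} {A} (A∈F , x∈A , A⁻∉F) = count-mono-< shrinks A A∉CF A∈F
    where
    shrinks : ∀ A → T (compress x F (outside ∷ A)) → T (F (outside ∷ A))
    shrinks A A∈CF with lookup A x
    ... | inside  = proj₁ (to T-∧ A∈CF)
    ... | outside = A∈CF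
    A∉CF : ¬ T (compress x F (outside ∷ A))
    A∉CF rewrite x∈A = A⁻∉F ∘ proj₂ ∘ to T-∧

IsLeftCompressed : ∀ {n} → Family (suc n) → Set
IsLeftCompressed {n} G = ∀ (x : Fin n) A → T (G A) → SwapClosed x G A

violation? : ∀ {n} (F : Family (suc n)) → Dec (∃ λ x → ∃ λ A → Violation x F A)
violation? F = any? λ x → anySubset? λ A → T? (F (outside ∷ A)) ×-dec (lookup A x Bool.≟ inside) ×-dec ¬? (T? _)

no-violation⇒compressed : ∀ {n} {F : Family (suc n)} → ¬ (∃ λ x → ∃ λ A → Violation x F A) → IsLeftCompressed F
no-violation⇒compressed ¬viol x (inside ∷ A)  _   = tt
no-violation⇒compressed ¬viol x (outside ∷ A) A∈F x∈A =
  decidable-stable (T? _) λ A⁻∉F → ¬viol (x , A , A∈F , x∈A , A⁻∉F)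

record LeftCompression {n} (r : ℕ) (F : Family (suc n)) : Set where
  field
    family     : Family (suc n)
    uniform    : IsUniform r family
    count≡     : count family ≡ count F
    shadow≤    : ∀ s → count (shadow s family) ≤ count (shadow s F)
    compressed : IsLeftCompressed family

leftCompression : ∀ {n r} (F : Family (suc n)) → IsUniform r F → LeftCompression r F
leftCompression {n} {r} F = go F (On.wellFounded (count ∘ deletion) <-wellFounded F)
  where
  go : ∀ F → Acc (_<_ on (count ∘ deletion)) F → IsUniform r F → LeftCompression r F
  go F (acc smaller) F-unif with violation? F
  ... | no ¬viol = record
    { family = F ; uniform = F-unif ; count≡ = refl ; shadow≤ = λ _ → ≤-refl
    ; compressed = no-violation⇒compressed ¬viol }
  ... | yes (x , A , viol) = record
    { family     = family
    ; uniform    = uniform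
    ; count≡     = trans count≡ (count-compress x F)
    ; shadow≤    = λ s → ≤-trans (shadow≤ s) (count-shadow-compress x s F)
    ; compressed = compressed }
    where open LeftCompression (go (compress x F) (smaller (count-deletion-compress-< x {F} {A} viol)) (compress-uniform x F-unif))

⊆-∣≡∣ : ∀ {n} {A B : Subset n} → B ⊆ A → ∣ A ∣ ≡ ∣ B ∣ → A ≡ B
⊆-∣≡∣ {A = []}          {[]}          _   _    = refl
⊆-∣≡∣ {A = inside ∷ A}  {inside ∷ B}  B⊆A size = cong (inside ∷_) (⊆-∣≡∣ (drop-∷-⊆ B⊆A) (suc-injective size))
⊆-∣≡∣ {A = outside ∷ A} {outside ∷ B} B⊆A size = cong (outside ∷_) (⊆-∣≡∣ (drop-∷-⊆ B⊆A) size)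
⊆-∣≡∣ {A = outside ∷ A} {inside ∷ B}  B⊆A size with () ← B⊆A here
⊆-∣≡∣ {A = inside ∷ A}  {outside ∷ B} B⊆A size =
  contradiction (p⊆q⇒∣p∣≤∣q∣ (drop-∷-⊆ B⊆A)) (<⇒≱ (≤-reflexive size))

⊆-∣suc∣ : ∀ {n} {A B : Subset n} → B ⊆ A → ∣ A ∣ ≡ suc ∣ B ∣ → ∃ λ y → lookup A y ≡ inside × A [ y ]≔ outside ≡ B
⊆-∣suc∣ {A = inside ∷ A}  {inside ∷ B}  B⊆A size with y , y∈A , A⁻≡B ← ⊆-∣suc∣ (drop-∷-⊆ B⊆A) (suc-injective size) =
  suc y , y∈A , cong (inside ∷_) A⁻≡B
⊆-∣suc∣ {A = outside ∷ A} {outside ∷ B} B⊆A size with y , y∈A , A⁻≡B ← ⊆-∣suc∣ (drop-∷-⊆ B⊆A) size =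
  suc y , y∈A , cong (outside ∷_) A⁻≡B
⊆-∣suc∣ {A = inside ∷ A}  {outside ∷ B} B⊆A size = zero , refl , cong (outside ∷_) (⊆-∣≡∣ (drop-∷-⊆ B⊆A) (suc-injective size))
⊆-∣suc∣ {A = outside ∷ A} {inside ∷ B}  B⊆A size with () ← B⊆A here

shadow-deletion⊆link : ∀ {n r} {G : Family (suc n)} → IsUniform (suc r) G → IsLeftCompressed G →
                       ∀ B → T (shadow r (deletion G) B) → T (link G B)
shadow-deletion⊆link {G = G} G-unif G-comp B B∈∂G₀
  with ∣B∣≡r , A , A∈G₀ , B⊆A ← shadow⁻ B∈∂G₀
  with y , y∈A , A⁻≡B ← ⊆-∣suc∣ B⊆A (trans (G-unif (outside ∷ A) A∈G₀) (cong suc (sym ∣B∣≡r)))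
  = subst (T ∘ link G) A⁻≡B (G-comp y (outside ∷ A) A∈G₀ y∈A)

-- Binomial sums

sum-applyUpTo-mono : ∀ L {g h : ℕ → ℕ} → (∀ d → d < L → g d ≤ h d) → sum (applyUpTo g L) ≤ sum (applyUpTo h L)
sum-applyUpTo-mono zero    g≤h = z≤n
sum-applyUpTo-mono (suc L) g≤h = +-mono-≤ (g≤h 0 (s≤s z≤n)) (sum-applyUpTo-mono L (λ d d<L → g≤h (suc d) (s≤s d<L)))

sum-applyUpTo-cong : ∀ L {g h : ℕ → ℕ} → (∀ d → g d ≡ h d) → sum (applyUpTo g L) ≡ sum (applyUpTo h L)
sum-applyUpTo-cong L g≡h = ≤-antisym (sum-applyUpTo-mono L λ d _ → ≤-reflexive (g≡h d))
                                     (sum-applyUpTo-mono L λ d _ → ≤-reflexive (sym (g≡h d)))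

sum-applyUpTo-+ : ∀ L (g h : ℕ → ℕ) → sum (applyUpTo (λ d → g d + h d) L) ≡ sum (applyUpTo g L) + sum (applyUpTo h L)
sum-applyUpTo-+ zero    g h = refl
sum-applyUpTo-+ (suc L) g h = trans (cong (g 0 + h 0 +_) (sum-applyUpTo-+ L (g ∘ suc) (h ∘ suc)))
                                    (interchange +-commutativeSemigroup (g 0) (h 0) _ _)

sum-applyUpTo-zero : ∀ L → sum (applyUpTo (λ _ → 0) L) ≡ 0
sum-applyUpTo-zero zero    = refl
sum-applyUpTo-zero (suc L) = sum-applyUpTo-zero L

in-range : ∀ j r d → d < suc r ∸ j → j + d ≤ r
in-range j r d d<len = ≤-pred (begin
  suc (j + d) ≡⟨ cong suc (+-comm j d) ⟩
  suc d + j   ≤⟨ m≤o∸n⇒m+n≤o (suc d) j≤1+r d<len ⟩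
  suc r       ∎)
  where
  open ≤-Reasoning
  j≤1+r : j ≤ suc r
  j≤1+r = <⇒≤ (m∸n≢0⇒n<m λ len≡0 → contradiction (subst (d <_) len≡0 d<len) λ ())

module _ (j r : ℕ) where

  sumFromTo-mono : ∀ {f g : ℕ → ℕ} → (∀ i → j ≤ i → i ≤ r → f i ≤ g i) → sumFromTo j r f ≤ sumFromTo j r g
  sumFromTo-mono f≤g = sum-applyUpTo-mono (suc r ∸ j) λ d d<len → f≤g (j + d) (m≤m+n j d) (in-range j r d d<len)

  sumFromTo-cong : ∀ {f g : ℕ → ℕ} → (∀ i → j ≤ i → i ≤ r → f i ≡ g i) → sumFromTo j r f ≡ sumFromTo j r g
  sumFromTo-cong f≡g = ≤-antisym (sumFromTo-mono λ i j≤i i≤r → ≤-reflexive (f≡g i j≤i i≤r))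
                                 (sumFromTo-mono λ i j≤i i≤r → ≤-reflexive (sym (f≡g i j≤i i≤r)))

  sumFromTo-+ : ∀ f g → sumFromTo j r (λ i → f i + g i) ≡ sumFromTo j r f + sumFromTo j r g
  sumFromTo-+ f g = sum-applyUpTo-+ (suc r ∸ j) (f ∘ (j +_)) (g ∘ (j +_))

  sumFromTo-zero : ∀ {f} → (∀ i → j ≤ i → i ≤ r → f i ≡ 0) → sumFromTo j r f ≡ 0
  sumFromTo-zero f≡0 = trans (sumFromTo-cong f≡0) (sum-applyUpTo-zero (suc r ∸ j))

sumFromTo-empty : ∀ j r f → r < j → sumFromTo j r f ≡ 0
sumFromTo-empty j r f r<j rewrite m≤n⇒m∸n≡0 r<j = refl

sumFromTo-unfold : ∀ j r f → j ≤ r → sumFromTo j r f ≡ f j + sumFromTo (suc j) r f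
sumFromTo-unfold j r f j≤r rewrite +-∸-assoc 1 j≤r =
  cong₂ _+_ (cong f (+-identityʳ j))
            (sum-applyUpTo-cong (r ∸ j) λ d → cong f (+-suc j d))

sumFromTo-head-≤ : ∀ j r f → j ≤ r → f j ≤ sumFromTo j r f
sumFromTo-head-≤ j r f j≤r = ≤-trans (m≤m+n (f j) _) (≤-reflexive (sym (sumFromTo-unfold j r f j≤r)))

chooseShift-< : ∀ a {i t} → i < t → chooseShift a i t ≡ 0
chooseShift-< a {zero}  {suc t} i<t       = refl
chooseShift-< a {suc i} {suc t} (s≤s i<t) = chooseShift-< a i<t

chooseShift-≥ : ∀ a {i t} → t ≤ i → chooseShift a i t ≡ a C (i ∸ t)
chooseShift-≥ a {i}     {zero}  t≤i       = refl
chooseShift-≥ a {suc i} {suc t} (s≤s t≤i) = chooseShift-≥ a t≤i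

pascal : ∀ a i → 1 ≤ a → 1 ≤ i → a C i ≡ (a ∸ 1) C (i ∸ 1) + (a ∸ 1) C i
pascal (suc a) (suc i) _ _ = sym (nCk+nC[k+1]≡[n+1]C[k+1] a i)

chooseShift-pascal : ∀ a i t → 1 ≤ a → 1 ≤ i →
  chooseShift a i (suc t) ≡ chooseShift (a ∸ 1) (i ∸ 1) (suc t) + chooseShift (a ∸ 1) (i ∸ 1) t
chooseShift-pascal (suc a) (suc i) t _ _ with <-cmp i t
... | tri< i<t _ _ rewrite chooseShift-< (suc a) (s≤s i<t) | chooseShift-< a (m<n⇒m<1+n i<t) | chooseShift-< a i<t = refl
... | tri≈ _ refl _ rewrite chooseShift-≥ (suc a) (≤-refl {suc i}) | chooseShift-< a (n<1+n i) | chooseShift-≥ a (≤-refl {i}) | n∸n≡0 i = refl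
... | tri> _ _ t<i rewrite chooseShift-≥ (suc a) (s≤s (<⇒≤ t<i)) | chooseShift-≥ a t<i | chooseShift-≥ a (<⇒≤ t<i) | +-∸-assoc 1 t<i =
  sym (nCk+nC[k+1]≡[n+1]C[k+1] a (i ∸ suc t))

[1+n]Cn≡1+n : ∀ n → suc n C n ≡ suc n
[1+n]Cn≡1+n n = trans (nCk≡nC[n∸k] (n≤1+n n)) (trans (cong (suc n C_) (m+n∸n≡m 1 n)) (nC1≡n (suc n)))

0<nCk : ∀ n k → k ≤ n → 0 < n C k
0<nCk n       zero    _         = s≤s z≤n
0<nCk (suc n) (suc k) (s≤s k≤n) = ≤-trans (0<nCk n k k≤n) (≤-trans (m≤m+n _ _) (≤-reflexive (nCk+nC[k+1]≡[n+1]C[k+1] n k)))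

chooseShift-n-n-1 : ∀ n → 1 ≤ n → chooseShift n n 1 ≡ n
chooseShift-n-n-1 (suc n) _ = [1+n]Cn≡1+n n

-- Cascades

record IsCascade (j r : ℕ) (q : ℕ → ℕ) : Set where
  field
    1≤j        : 1 ≤ j
    j≤q[j]     : j ≤ r → j ≤ q j
    increasing : ∀ i → j ≤ i → i < r → q i < q (suc i)

module _ {j r q} (c : IsCascade j r q) where
  open IsCascade c

  i≤q[i] : ∀ i → j ≤ i → i ≤ r → i ≤ q i
  i≤q[i] i j≤i i≤r with m≤n⇒m<n∨m≡n j≤i
  ... | inj₂ refl = j≤q[j] i≤r
  i≤q[i] (suc i) j≤i i≤r | inj₁ j<1+i = ≤-trans (s≤s (i≤q[i] i (≤-pred j<1+i) (<⇒≤ i≤r))) (increasing i (≤-pred j<1+i) i≤r)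

  1≤q[i] : ∀ i → j ≤ i → i ≤ r → 1 ≤ q i
  1≤q[i] i j≤i i≤r = ≤-trans (≤-trans 1≤j j≤i) (i≤q[i] i j≤i i≤r)

  cascade-tail : IsCascade (suc j) r q
  cascade-tail = record
    { 1≤j        = s≤s z≤n
    ; j≤q[j]     = λ j<r → ≤-trans (s≤s (j≤q[j] (<⇒≤ j<r))) (increasing j ≤-refl j<r)
    ; increasing = λ i j<i → increasing i (<⇒≤ j<i)
    }

  cascade-pred : (j ≤ r → j < q j) → IsCascade j r (λ i → q i ∸ 1)
  cascade-pred j<q[j] = record
    { 1≤j        = 1≤j
    ; j≤q[j]     = λ j≤r → m+n≤o⇒m≤o∸n j (≤-trans (≤-reflexive (+-comm j 1)) (j<q[j] j≤r))
    ; increasing = λ i j≤i i<r → ∸-monoˡ-< (increasing i j≤i i<r) (1≤q[i] i j≤i (<⇒≤ i<r))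
    }

  pascal-sum : sumFromTo j r (λ i → q i C i) ≡ sumFromTo j r (λ i → (q i ∸ 1) C (i ∸ 1)) + sumFromTo j r (λ i → (q i ∸ 1) C i)
  pascal-sum = trans (sumFromTo-cong j r λ i j≤i i≤r → pascal (q i) i (1≤q[i] i j≤i i≤r) (≤-trans 1≤j j≤i))
                     (sumFromTo-+ j r (λ i → (q i ∸ 1) C (i ∸ 1)) (λ i → (q i ∸ 1) C i))

  chooseShift-pascal-sum : ∀ t → sumFromTo j r (λ i → chooseShift (q i) i (suc t))
    ≡ sumFromTo j r (λ i → chooseShift (q i ∸ 1) (i ∸ 1) (suc t)) + sumFromTo j r (λ i → chooseShift (q i ∸ 1) (i ∸ 1) t)
  chooseShift-pascal-sum t = trans (sumFromTo-cong j r λ i j≤i i≤r → chooseShift-pascal (q i) i t (1≤q[i] i j≤i i≤r) (≤-trans 1≤j j≤i))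
                                   (sumFromTo-+ j r (λ i → chooseShift (q i ∸ 1) (i ∸ 1) (suc t)) (λ i → chooseShift (q i ∸ 1) (i ∸ 1) t))

cascade-shift : ∀ {j r q} → IsCascade (suc j) (suc r) q → 1 ≤ j → IsCascade j r (λ i → q (suc i))
cascade-shift c j≥1 = record
  { 1≤j        = j≥1
  ; j≤q[j]     = λ j≤r → ≤-trans (n≤1+n _) (j≤q[j] (s≤s j≤r))
  ; increasing = λ i j≤i i<r → increasing (suc i) (s≤s j≤i) (s≤s i<r)
  }
  where open IsCascade c

lowerAfter : ℕ → (ℕ → ℕ) → ℕ → ℕ
lowerAfter j q i with i ≤? j
... | yes _ = q i
... | no  _ = q i ∸ 1

lowerAfter-≤ : ∀ {j q i} → i ≤ j → lowerAfter j q i ≡ q i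
lowerAfter-≤ {j} {q} {i} i≤j with i ≤? j
... | yes _   = refl
... | no  i≰j = contradiction i≤j i≰j

lowerAfter-> : ∀ {j q i} → j < i → lowerAfter j q i ≡ q i ∸ 1
lowerAfter-> {j} {q} {i} j<i with i ≤? j
... | yes i≤j = contradiction j<i (≤⇒≯ i≤j)
... | no  _   = refl

cascade-lowerAfter : ∀ {j r q} → IsCascade j r q → q j ≡ j → (j < r → suc j < q (suc j)) →
                     IsCascade j r (lowerAfter j q)
cascade-lowerAfter {j} {r} {q} c q[j]≡j gap = record
  { 1≤j        = 1≤j
  ; j≤q[j]     = λ _ → ≤-reflexive (sym (trans (lowerAfter-≤ {j} {q} ≤-refl) q[j]≡j))
  ; increasing = increasing′
  }
  where
  open IsCascade c
  increasing′ : ∀ i → j ≤ i → i < r → lowerAfter j q i < lowerAfter j q (suc i)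
  increasing′ i j≤i i<r with m≤n⇒m<n∨m≡n j≤i
  ... | inj₂ refl rewrite lowerAfter-≤ {j} {q} ≤-refl | q[j]≡j | lowerAfter-> {j} {q} (n<1+n j) =
    m+n≤o⇒m≤o∸n (suc j) (≤-trans (≤-reflexive (+-comm (suc j) 1)) (gap i<r))
  ... | inj₁ j<i rewrite lowerAfter-> {j} {q} j<i | lowerAfter-> {j} {q} (m<n⇒m<1+n j<i) =
    ∸-monoˡ-< (increasing i j≤i i<r) (1≤q[i] c i j≤i (<⇒≤ i<r))

tight-head-C[q∸1,i] : ∀ j r (q : ℕ → ℕ) → 1 ≤ j → j ≤ r → q j ≡ j →
  sumFromTo j r (λ i → (q i ∸ 1) C i) ≡ sumFromTo (suc j) r (λ i → (q i ∸ 1) C i)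
tight-head-C[q∸1,i] (suc j) r q _ j<r q[1+j]≡1+j rewrite sumFromTo-unfold (suc j) r (λ i → (q i ∸ 1) C i) j<r
                                                       | q[1+j]≡1+j | k>n⇒nCk≡0 (n<1+n j) = refl

tight-head-C[q∸1,i∸1] : ∀ j r (q : ℕ → ℕ) → 1 ≤ j → j ≤ r → q j ≡ j →
  sumFromTo j r (λ i → (q i ∸ 1) C (i ∸ 1)) ≡ suc (sumFromTo (suc j) r (λ i → (q i ∸ 1) C (i ∸ 1)))
tight-head-C[q∸1,i∸1] (suc j) r q _ j<r q[1+j]≡1+j rewrite sumFromTo-unfold (suc j) r (λ i → (q i ∸ 1) C (i ∸ 1)) j<r
                                                         | q[1+j]≡1+j | nCn≡1 j = refl

-- The Kruskal–Katona theorem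

KruskalKatona : ℕ → Set
KruskalKatona n = ∀ {r j q} (F : Family n) → IsUniform r F → IsCascade j r q →
  sumFromTo j r (λ i → q i C i) ≤ count F →
  ∀ t → sumFromTo j r (λ i → chooseShift (q i) i t) ≤ count (shadow (r ∸ t) F)

kruskalKatona-zero : KruskalKatona 0
kruskalKatona-zero {r} {j} {q} F F-unif c hyp t with r <? j
... | yes r<j = ≤-trans (≤-reflexive (sumFromTo-empty j r (λ i → chooseShift (q i) i t) r<j)) z≤n
... | no  r≮j = contradiction (F-unif [] ∅∈F) (<⇒≢ (≤-trans (IsCascade.1≤j c) j≤r))
  where
  j≤r = ≮⇒≥ r≮j
  0<count : 0 < count F
  0<count = ≤-trans (0<nCk (q j) j (IsCascade.j≤q[j] c j≤r)) (≤-trans (sumFromTo-head-≤ j r (λ i → q i C i) j≤r) hyp)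
  ∅∈F : T (F [])
  ∅∈F with F [] | 0<count
  ... | true | _ = _

module _ {n} (IH : KruskalKatona n) where

  link-bound-from-2 : ∀ {r j q} {G₁ : Family n} → IsUniform r G₁ → IsCascade (suc (suc j)) (suc r) q →
    sumFromTo (suc (suc j)) (suc r) (λ i → (q i ∸ 1) C (i ∸ 1)) ≤ count G₁ →
    ∀ t → sumFromTo (suc (suc j)) (suc r) (λ i → chooseShift (q i ∸ 1) (i ∸ 1) t) ≤ count (shadow (r ∸ t) G₁)
  link-bound-from-2 G₁-unif c hyp =
    IH _ G₁-unif (cascade-pred (cascade-shift c (s≤s z≤n)) λ j≤r → IsCascade.j≤q[j] c (s≤s j≤r)) hyp

  link-bound : ∀ {r j q} {G₁ : Family n} → IsUniform r G₁ → IsCascade j (suc r) q →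
    sumFromTo j (suc r) (λ i → (q i ∸ 1) C (i ∸ 1)) ≤ count G₁ →
    ∀ t → sumFromTo j (suc r) (λ i → chooseShift (q i ∸ 1) (i ∸ 1) t) ≤ count (shadow (r ∸ t) G₁)
  link-bound {j = suc (suc j)} = link-bound-from-2
  link-bound {j = 1}           G₁-unif c hyp zero    = ≤-trans hyp (count-shadow-self G₁-unif)
  link-bound {r} {j = 1} {q}   G₁-unif c hyp (suc t) =
    ≤-trans (≤-reflexive (sumFromTo-unfold 1 (suc r) (λ i → chooseShift (q i ∸ 1) (i ∸ 1) (suc t)) (s≤s z≤n)))
            (link-bound-from-2 G₁-unif (cascade-tail c) hyp₂ (suc t))
    where
    hyp₂ = ≤-trans (≤-trans (m≤n+m _ _) (≤-reflexive (sym (sumFromTo-unfold 1 (suc r) (λ i → (q i ∸ 1) C (i ∸ 1)) (s≤s z≤n))))) hyp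
  link-bound {j = zero} _ c = contradiction (IsCascade.1≤j c) λ ()

  -- Lowering only the terms after j keeps a cascade, and turns the excess 1 into the head term C(j, j).
  lowered-bound : ∀ {r j q} {H : Family n} → IsUniform r H → IsCascade j r q → j ≤ r → q j ≡ j →
    (j < r → suc j < q (suc j)) →
    suc (sumFromTo (suc j) r (λ i → (q i ∸ 1) C i)) ≤ count H →
    sumFromTo (suc j) r (λ i → (q i ∸ 1) C (i ∸ 1)) + j ≤ count (shadow (r ∸ 1) H)
  lowered-bound {r} {j} {q} {H} H-unif c j≤r q[j]≡j gap hyp = begin
    sumFromTo (suc j) r (λ i → (q i ∸ 1) C (i ∸ 1)) + j ≡⟨ +-comm _ j ⟩
    j + sumFromTo (suc j) r (λ i → (q i ∸ 1) C (i ∸ 1)) ≡⟨ lowered-shadow-sum ⟨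
    sumFromTo j r (λ i → chooseShift (p i) i 1)         ≤⟨ IH H H-unif (cascade-lowerAfter c q[j]≡j gap) lowered-hyp 1 ⟩
    count (shadow (r ∸ 1) H)                            ∎
    where
    open ≤-Reasoning
    p = lowerAfter j q
    1≤j = IsCascade.1≤j c
    p[j]≡j : p j ≡ j
    p[j]≡j = trans (lowerAfter-≤ {j} {q} ≤-refl) q[j]≡j
    lowered-hyp : sumFromTo j r (λ i → p i C i) ≤ count H
    lowered-hyp = ≤-trans (≤-reflexive (trans (sumFromTo-unfold j r (λ i → p i C i) j≤r)
                    (cong₂ _+_ (trans (cong (_C j) p[j]≡j) (nCn≡1 j))
                               (sumFromTo-cong (suc j) r λ i j<i _ → cong (_C i) (lowerAfter-> {j} {q} j<i))))) hyp
    lowered-shadow-sum : sumFromTo j r (λ i → chooseShift (p i) i 1) ≡ j + sumFromTo (suc j) r (λ i → (q i ∸ 1) C (i ∸ 1))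
    lowered-shadow-sum = trans (sumFromTo-unfold j r (λ i → chooseShift (p i) i 1) j≤r)
      (cong₂ _+_ head tail)
      where
      head : chooseShift (p j) j 1 ≡ j
      head = trans (cong (λ a → chooseShift a j 1) p[j]≡j) (chooseShift-n-n-1 j 1≤j)
      tail : sumFromTo (suc j) r (λ i → chooseShift (p i) i 1) ≡ sumFromTo (suc j) r (λ i → (q i ∸ 1) C (i ∸ 1))
      tail = sumFromTo-cong (suc j) r λ i j<i _ →
        trans (cong (λ a → chooseShift a i 1) (lowerAfter-> {j} {q} j<i)) (chooseShift-≥ _ (≤-trans 1≤j (<⇒≤ j<i)))

  tight-excess-bound : ∀ d {r j q} {H : Family n} → j + d ≡ r → IsUniform r H → IsCascade j r q → q j ≡ j →
    suc (sumFromTo (suc j) r (λ i → (q i ∸ 1) C i)) ≤ count H →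
    sumFromTo (suc j) r (λ i → (q i ∸ 1) C (i ∸ 1)) + j ≤ count (shadow (r ∸ 1) H)
  tight-excess-bound zero {j = j} refl H-unif c q[j]≡j hyp =
    lowered-bound H-unif c (m≤m+n j 0) q[j]≡j (λ j<j+0 → contradiction j<j+0 (<-irrefl (sym (+-identityʳ j)))) hyp
  tight-excess-bound (suc d) {r} {j} {q} {H} j+1+d≡r H-unif c q[j]≡j hyp
    with q (suc j) ≟ suc j | subst (j <_) j+1+d≡r (m<m+n j (s≤s z≤n))
  ... | no q[1+j]≢1+j | j<r = lowered-bound H-unif c (<⇒≤ j<r) q[j]≡j (λ _ → ≤∧≢⇒< (IsCascade.j≤q[j] (cascade-tail c) j<r) (q[1+j]≢1+j ∘ sym)) hyp
  ... | yes q[1+j]≡1+j | j<r = begin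
    sumFromTo (suc j) r (λ i → (q i ∸ 1) C (i ∸ 1)) + j           ≡⟨ cong (_+ j) (tight-head-C[q∸1,i∸1] (suc j) r q (s≤s z≤n) j<r q[1+j]≡1+j) ⟩
    suc (sumFromTo (suc (suc j)) r (λ i → (q i ∸ 1) C (i ∸ 1))) + j ≡⟨ +-suc _ j ⟨
    sumFromTo (suc (suc j)) r (λ i → (q i ∸ 1) C (i ∸ 1)) + suc j   ≤⟨ tight-excess-bound d (trans (sym (+-suc j d)) j+1+d≡r) H-unif (cascade-tail c) q[1+j]≡1+j hyp′ ⟩
    count (shadow (r ∸ 1) H)                                          ∎
    where
    open ≤-Reasoning
    hyp′ = ≤-trans (≤-reflexive (cong suc (sym (tight-head-C[q∸1,i] (suc j) r q (s≤s z≤n) j<r q[1+j]≡1+j)))) hyp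

  excess-bound : ∀ {r j q} {H : Family n} → IsUniform r H → IsCascade j r q → j ≤ r →
    suc (sumFromTo j r (λ i → (q i ∸ 1) C i)) ≤ count H →
    sumFromTo j r (λ i → (q i ∸ 1) C (i ∸ 1)) ≤ count (shadow (r ∸ 1) H)
  excess-bound {r} {j} {q} {H} H-unif c j≤r hyp with m≤n⇒m<n∨m≡n (IsCascade.j≤q[j] c j≤r)
  ... | inj₂ j≡q[j] = begin
    sumFromTo j r (λ i → (q i ∸ 1) C (i ∸ 1))             ≡⟨ tight-head-C[q∸1,i∸1] j r q 1≤j j≤r (sym j≡q[j]) ⟩
    suc (sumFromTo (suc j) r (λ i → (q i ∸ 1) C (i ∸ 1))) ≡⟨ +-comm 1 _ ⟩
    sumFromTo (suc j) r (λ i → (q i ∸ 1) C (i ∸ 1)) + 1   ≤⟨ +-monoʳ-≤ _ 1≤j ⟩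
    sumFromTo (suc j) r (λ i → (q i ∸ 1) C (i ∸ 1)) + j   ≤⟨ tight-excess-bound (r ∸ j) (m+[n∸m]≡n j≤r) H-unif c (sym j≡q[j]) tight-hyp ⟩
    count (shadow (r ∸ 1) H)                              ∎
    where
    open ≤-Reasoning
    1≤j = IsCascade.1≤j c
    tight-hyp = ≤-trans (≤-reflexive (cong suc (sym (tight-head-C[q∸1,i] j r q 1≤j j≤r (sym j≡q[j]))))) hyp
  ... | inj₁ j<q[j] = begin
    sumFromTo j r (λ i → (q i ∸ 1) C (i ∸ 1))  ≡⟨ sumFromTo-cong j r (λ i j≤i _ → chooseShift-≥ (q i ∸ 1) (≤-trans (IsCascade.1≤j c) j≤i)) ⟨
    sumFromTo j r (λ i → chooseShift (q i ∸ 1) i 1) ≤⟨ IH H H-unif (cascade-pred c (λ _ → j<q[j])) (≤-trans (n≤1+n _) hyp) 1 ⟩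
    count (shadow (r ∸ 1) H)                   ∎
    where open ≤-Reasoning

  -- A smaller link would leave the deletion one above its cascade sum, and its shadow, which
  -- lies in the link, would then be too large.
  compressed-link-bound : ∀ {r j q} {G : Family (suc n)} → IsUniform (suc r) G → IsLeftCompressed G →
    IsCascade j (suc r) q → j ≤ suc r →
    sumFromTo j (suc r) (λ i → q i C i) ≤ count G →
    sumFromTo j (suc r) (λ i → (q i ∸ 1) C (i ∸ 1)) ≤ count (link G)
  compressed-link-bound {r} {j} {q} {G} G-unif G-comp c j≤1+r hyp
    with sumFromTo j (suc r) (λ i → (q i ∸ 1) C (i ∸ 1)) ≤? count (link G)
  ... | yes L≤G₁ = L≤G₁
  ... | no  L≰G₁ = contradiction (≤-trans (excess-bound G₀-unif c j≤1+r deletion-large)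
                                          (count-mono (shadow-deletion⊆link G-unif G-comp))) L≰G₁
    where
    G₀-unif : IsUniform (suc r) (deletion G)
    G₀-unif A = G-unif (outside ∷ A)
    deletion-large : suc (sumFromTo j (suc r) (λ i → (q i ∸ 1) C i)) ≤ count (deletion G)
    deletion-large = +-cancelˡ-< _ _ _ (≤-<-trans (≤-trans (≤-reflexive (sym (pascal-sum c))) hyp)
                                                 (+-monoˡ-< (count (deletion G)) (≰⇒> L≰G₁)))

  compressed-bound : ∀ {r j q} {G : Family (suc n)} → IsUniform (suc r) G → IsLeftCompressed G →
    IsCascade j (suc r) q → j ≤ suc r →
    sumFromTo j (suc r) (λ i → q i C i) ≤ count G →
    ∀ t → sumFromTo j (suc r) (λ i → chooseShift (q i) i (suc t)) ≤ count (shadow (r ∸ t) G)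
  compressed-bound {r} {j} {q} {G} G-unif G-comp c j≤1+r hyp t = begin
    sumFromTo j (suc r) (λ i → chooseShift (q i) i (suc t))
      ≡⟨ chooseShift-pascal-sum c t ⟩
    sumFromTo j (suc r) (λ i → chooseShift (q i ∸ 1) (i ∸ 1) (suc t)) + sumFromTo j (suc r) (λ i → chooseShift (q i ∸ 1) (i ∸ 1) t)
      ≤⟨ count-shadow-via-link r t G (link-bound′ (suc t)) (link-bound′ t) vanishes ⟩
    count (shadow (r ∸ t) G) ∎
    where
    open ≤-Reasoning
    G₁-unif : IsUniform r (link G)
    G₁-unif A A∈G₁ = suc-injective (G-unif (inside ∷ A) A∈G₁)
    link-bound′ = link-bound G₁-unif c (compressed-link-bound G-unif G-comp c j≤1+r hyp)
    vanishes : r ≤ t → sumFromTo j (suc r) (λ i → chooseShift (q i ∸ 1) (i ∸ 1) (suc t)) ≡ 0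
    vanishes r≤t = sumFromTo-zero j (suc r) λ i _ i≤1+r → chooseShift-< (q i ∸ 1) (s≤s (≤-trans (∸-monoˡ-≤ 1 i≤1+r) r≤t))

kruskalKatona-suc : ∀ {n} → KruskalKatona n → KruskalKatona (suc n)
kruskalKatona-suc IH F F-unif c hyp zero = ≤-trans hyp (count-shadow-self F-unif)
kruskalKatona-suc IH {zero} {j} {q} F F-unif c hyp (suc t) =
  ≤-trans (≤-reflexive (sumFromTo-empty j 0 (λ i → chooseShift (q i) i (suc t)) (IsCascade.1≤j c))) z≤n
kruskalKatona-suc IH {suc r} {j} {q} F F-unif c hyp (suc t) with suc r <? j
... | yes r<j = ≤-trans (≤-reflexive (sumFromTo-empty j (suc r) (λ i → chooseShift (q i) i (suc t)) r<j)) z≤n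
... | no  r≮j = begin
  sumFromTo j (suc r) (λ i → chooseShift (q i) i (suc t)) ≤⟨ compressed-bound IH uniform compressed c (≮⇒≥ r≮j) hyp′ t ⟩
  count (shadow (r ∸ t) family)                           ≤⟨ shadow≤ (r ∸ t) ⟩
  count (shadow (r ∸ t) F)                                ∎
  where
  open ≤-Reasoning
  open LeftCompression (leftCompression F F-unif)
  hyp′ = ≤-trans hyp (≤-reflexive (sym count≡))

kruskalKatona : ∀ n → KruskalKatona n
kruskalKatona zero    = kruskalKatona-zero
kruskalKatona (suc n) = kruskalKatona-suc (kruskalKatona n)

-- Independent sets of Kneser graphs

length-filter-map : ∀ {ℓ} {A B : Set} {P : Pred B ℓ} (P? : Decidable P) (f : A → B) xs →
  length (filter P? (map f xs)) ≡ length (filter (P? ∘ f) xs)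
length-filter-map P? f []       = refl
length-filter-map P? f (x ∷ xs) with does (P? (f x))
... | true  = cong suc (length-filter-map P? f xs)
... | false = length-filter-map P? f xs

length-filter-allSubsets : ∀ {ℓ} n {P : Pred (Subset n) ℓ} (P? : Decidable P) →
  length (filter P? (allSubsets n)) ≡ count (does ∘ P?)
length-filter-allSubsets zero P? with P? []
... | yes _ = refl
... | no  _ = refl
length-filter-allSubsets (suc n) P? = begin
  length (filter P? (map (inside ∷_) (allSubsets n) ++ map (outside ∷_) (allSubsets n)))
    ≡⟨ cong length (filter-++ P? (map (inside ∷_) (allSubsets n)) _) ⟩
  length (filter P? (map (inside ∷_) (allSubsets n)) ++ filter P? (map (outside ∷_) (allSubsets n)))
    ≡⟨ length-++ (filter P? (map (inside ∷_) (allSubsets n))) ⟩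
  length (filter P? (map (inside ∷_) (allSubsets n))) + length (filter P? (map (outside ∷_) (allSubsets n)))
    ≡⟨ cong₂ _+_ (trans (length-filter-map P? (inside ∷_) (allSubsets n)) (length-filter-allSubsets n (P? ∘ (inside ∷_))))
                 (trans (length-filter-map P? (outside ∷_) (allSubsets n)) (length-filter-allSubsets n (P? ∘ (outside ∷_)))) ⟩
  count (does ∘ P?) ∎
  where open ≡-Reasoning

_≟ˢ_ : ∀ {n} → DecidableEquality (Subset n)
_≟ˢ_ = VecProperties.≡-dec Bool._≟_

count-≟ˢ : ∀ {n} (B : Subset n) → count (λ A → does (A ≟ˢ B)) ≡ 1
count-≟ˢ           []            = refl
count-≟ˢ {suc n} (inside ∷ B)  = cong₂ _+_ (count-≟ˢ B) (sumSubsets-zero n)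
count-≟ˢ {suc n} (outside ∷ B) = cong₂ _+_ (sumSubsets-zero n) (count-≟ˢ B)

_∈?_ : ∀ {n} (A : Subset n) (Q : List (Subset n)) → Dec (A ∈ Q)
A ∈? Q = DecMembership._∈?_ _≟ˢ_ A Q

memberOf : ∀ {n} → List (Subset n) → Family n
memberOf Q A = does (A ∈? Q)

count-memberOf : ∀ {n} (Q : List (Subset n)) → Unique Q → count (memberOf Q) ≡ length Q
count-memberOf {n} []      _          = sumSubsets-zero n
count-memberOf {n} (B ∷ Q) (B∉Q ∷ Q!) = begin
  count (memberOf (B ∷ Q))                                   ≡⟨ sumSubsets-cong split ⟩
  sumSubsets n (λ A → 𝟙 (does (A ≟ˢ B)) + 𝟙 (memberOf Q A)) ≡⟨ sumSubsets-+ (λ A → 𝟙 (does (A ≟ˢ B))) (𝟙 ∘ memberOf Q) ⟩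
  count (λ A → does (A ≟ˢ B)) + count (memberOf Q)          ≡⟨ cong₂ _+_ (count-≟ˢ B) (count-memberOf Q Q!) ⟩
  suc (length Q)                                             ∎
  where
  open ≡-Reasoning
  split : ∀ A → 𝟙 (memberOf (B ∷ Q) A) ≡ 𝟙 (does (A ≟ˢ B)) + 𝟙 (memberOf Q A)
  split A with A ≟ˢ B
  ... | no  _    = refl
  ... | yes refl rewrite dec-false (A ∈? Q) (All¬⇒¬Any B∉Q) = refl

does⁺ : ∀ {P : Set} (P? : Dec P) → P → T (does P?)
does⁺ P? p rewrite dec-true P? p = _

does⁻ : ∀ {P : Set} (P? : Dec P) → T (does P?) → P
does⁻ (yes p) _ = p

complements : ∀ {n} → List (Subset n) → Family n
complements Q = memberOf Q ∘ ∁

count-complements : ∀ {n} (Q : List (Subset n)) → Unique Q → count (complements Q) ≡ length Q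
count-complements Q Q! = trans (sumSubsets-∁ (𝟙 ∘ memberOf Q)) (count-memberOf Q Q!)

complements-uniform : ∀ {n k} {Q : List (Subset n)} → (∀ {A} → A ∈ Q → ∣ A ∣ ≡ k) → IsUniform (n ∸ k) (complements Q)
complements-uniform {n} {k} {Q} Q-sized A ∁A∈Q = begin
  ∣ A ∣           ≡⟨ m∸[m∸n]≡n (∣p∣≤n A) ⟨
  n ∸ (n ∸ ∣ A ∣) ≡⟨ cong (n ∸_) (∣∁p∣≡n∸∣p∣ A) ⟨
  n ∸ ∣ ∁ A ∣     ≡⟨ cong (n ∸_) (Q-sized (does⁻ (∁ A ∈? Q) ∁A∈Q)) ⟩
  n ∸ k           ∎
  where open ≡-Reasoning

shadow-complements⊆nbhd : ∀ {n k} {Q : List (Subset n)} → (∀ {A B} → A ∈ Q → B ∈ Q → ¬ KAdj A B) →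
                          ∀ B → T (shadow k (complements Q) B) → InNbhd k Q B
shadow-complements⊆nbhd {Q = Q} Q-indep B B∈∂
  with ∣B∣≡k , A , ∁A∈Q′ , B⊆A ← shadow⁻ B∈∂ =
  ∣B∣≡k , (λ B∈Q → Q-indep ∁A∈Q B∈Q ∁A∩B≡∅) , Any.map (λ ∁A≡ → subst (λ A′ → KAdj A′ B) ∁A≡ ∁A∩B≡∅) ∁A∈Q
  where
  ∁A∈Q = does⁻ (∁ A ∈? Q) ∁A∈Q′
  ∁A∩B≡∅ : Empty (∁ A ∩ B)
  ∁A∩B≡∅ (y , y∈∁A∩B) with y∈∁A , y∈B ← x∈p∩q⁻ (∁ A) B y∈∁A∩B = x∈∁p⇒x∉p y∈∁A (B⊆A y∈B)

count-shadow-complements≤nbhdSize : ∀ {n k} {Q : List (Subset n)} → (∀ {A B} → A ∈ Q → B ∈ Q → ¬ KAdj A B) →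
                                    count (shadow k (complements Q)) ≤ nbhdSize n k Q
count-shadow-complements≤nbhdSize {n} {k} {Q} Q-indep =
  ≤-trans (count-mono λ B B∈∂ → does⁺ (InNbhd? k Q B) (shadow-complements⊆nbhd Q-indep B B∈∂))
          (≤-reflexive (sym (length-filter-allSubsets n (InNbhd? k Q))))

n∸k∸[n∸2k]≡k : ∀ n k → 2 * k ≤ n → (n ∸ k) ∸ (n ∸ 2 * k) ≡ k
n∸k∸[n∸2k]≡k n k 2k≤n = begin
  (n ∸ k) ∸ (n ∸ 2 * k)       ≡⟨ cong ((n ∸ k) ∸_) n∸2k≡n∸k∸k ⟩
  (n ∸ k) ∸ ((n ∸ k) ∸ k)     ≡⟨ m∸[m∸n]≡n (m+n≤o⇒m≤o∸n k k+k≤n) ⟩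
  k                           ∎
  where
  open ≡-Reasoning
  k+k≤n : k + k ≤ n
  k+k≤n = subst (_≤ n) (cong (k +_) (+-identityʳ k)) 2k≤n
  n∸2k≡n∸k∸k : n ∸ 2 * k ≡ (n ∸ k) ∸ k
  n∸2k≡n∸k∸k = trans (cong (n ∸_) (cong (k +_) (+-identityʳ k))) (sym (∸-+-assoc n k k))

lemma12 : (n k : ℕ) → 2 * k + 1 ≤ n → 5 ≤ 2 * k + 1 →
    (Q : List (Subset n)) → Unique Q → IsIndependent k Q →
    (j : ℕ) (q : ℕ → ℕ) →
    1 ≤ j → j ≤ n ∸ k → j ≤ q j →
    (∀ i → j ≤ i → i < n ∸ k → q i < q (suc i)) →
    length Q ≡ sumFromTo j (n ∸ k) (λ i → q i C i) →
    sumFromTo j (n ∸ k) (λ i → chooseShift (q i) i (n ∸ 2 * k)) ≤ nbhdSize n k Q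
lemma12 n k 2k+1≤n _ Q Q! (Q-sized , Q-indep) j q 1≤j _ j≤q[j] increasing |Q|≡ = begin
  sumFromTo j (n ∸ k) (λ i → chooseShift (q i) i (n ∸ 2 * k))
    ≤⟨ kruskalKatona n (complements Q) (complements-uniform Q-sized) cascade hyp (n ∸ 2 * k) ⟩
  count (shadow ((n ∸ k) ∸ (n ∸ 2 * k)) (complements Q))
    ≡⟨ cong (λ s → count (shadow s (complements Q))) (n∸k∸[n∸2k]≡k n k (≤-trans (m≤m+n (2 * k) 1) 2k+1≤n)) ⟩
  count (shadow k (complements Q))
    ≤⟨ count-shadow-complements≤nbhdSize Q-indep ⟩
  nbhdSize n k Q ∎
  where
  open ≤-Reasoning
  cascade : IsCascade j (n ∸ k) q
  cascade = record { 1≤j = 1≤j ; j≤q[j] = λ _ → j≤q[j] ; increasing = increasing }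
  hyp = ≤-reflexive (trans (sym |Q|≡) (sym (count-complements Q Q!)))
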